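{- Let $r$ be a positive integer, $\mu>0$ a real, and let $\mathcal{G}$ be an $r$-uniform multi-hypergraph on $N$ vertices with $\Delta(\mathcal{G})\leq \mu d(\mathcal{G})$. Let $t$ be a positive integer with $t\leq \frac{N}{2r^2\mu}+1$. Then $\mathcal{G}$ contains at least $\left(\frac{e(\mathcal{G})}{2t}\right)^t$ matchings of size $t$.
   Context: An $r$-uniform multi-hypergraph is a finite vertex set together with a multiset of $r$-element subsets (edges); $e(\mathcal{G})$ is the number of edges counted with multiplicity, and parallel copies of an edge are regarded as distinct edges. The degree of a vertex is the number of edges containing it; $d(\mathcal{G})$ and $\Delta(\mathcal{G})$ are the average and maximum degree. A matching of size $t$ is a set of $t$ pairwise disjoint edges.
   Formalization: The parameter μ ranges over the positive rationals rather than the positive reals. -}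

module Defs where

open import Data.Nat as ℕ using (ℕ; zero; suc; _⊔_; NonZero)
open import Data.Nat.Properties using (m*n≢0)
open import Data.Integer using (+_)
open import Data.Rational using (ℚ; _/_; _*_; _+_; 1ℚ; 1/_; Positive)
open import Data.Rational.Properties using (pos⇒nonZero)
open import Data.Fin using (Fin; _≟_)
open import Data.Fin.Subset using (Subset; _∈_; ∣_∣)
open import Data.Fin.Subset.Properties using (_∈?_)
open import Data.Fin.Properties using (all?)
open import Data.Vec using (Vec; []; _∷_; tabulate)
open import Data.Bool using (Bool; true; false)
open import Data.List using (List; []; _∷_; _++_; map; filter; length; foldr; allFin)
open import Data.Nat.ListAction using (sum)
open import Data.Product using (_×_)
open import Data.Empty using (⊥)
open import Relation.Nullary using (Dec; ¬_; does)
open import Relation.Nullary.Decidable using (_×-dec_; _→-dec_; ¬?)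
open import Relation.Binary.PropositionalEquality using (_≡_)

-- An r-uniform multi-hypergraph on vertex set Fin N with m edges.
-- Edges are indexed by Fin m, so parallel copies are distinct edges.
record MultiHypergraph (r N : ℕ) : Set where
  field
    m       : ℕ
    edge    : Fin m → Subset N
    uniform : ∀ i → ∣ edge i ∣ ≡ r

open MultiHypergraph public

e : ∀ {r N} → MultiHypergraph r N → ℕ
e G = m G

degree : ∀ {r N} (G : MultiHypergraph r N) → Fin N → ℕ
degree G v = ∣ tabulate (λ i → does (v ∈? edge G i)) ∣

-- maximum degree Δ(G) (0 if there are no vertices)
Δ : ∀ {r N} → MultiHypergraph r N → ℕ
Δ {N = N} G = foldr _⊔_ 0 (map (degree G) (allFin N))

d : ∀ {r N} .{{_ : NonZero N}} → MultiHypergraph r N → ℚ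
d {N = N} G = (+ sum (map (degree G) (allFin N))) / N

ℕ→ℚ : ℕ → ℚ
ℕ→ℚ n = (+ n) / 1

_^ℚ_ : ℚ → ℕ → ℚ
q ^ℚ zero = 1ℚ
q ^ℚ suc n = q * (q ^ℚ n)

tBound : (N r : ℕ) .{{_ : NonZero r}} (μ : ℚ) .{{_ : Positive μ}} → ℚ
tBound N r μ = (_/_ (+ N) (2 ℕ.* (r ℕ.* r)) {{m*n≢0 2 (r ℕ.* r) {{_}} {{m*n≢0 r r}}}})
               * (1/ μ) {{pos⇒nonZero μ}} + 1ℚ

Disjoint : ∀ {N} → Subset N → Subset N → Set
Disjoint A B = ∀ v → v ∈ A → v ∈ B → ⊥

Disjoint? : ∀ {N} (A B : Subset N) → Dec (Disjoint A B)
Disjoint? A B = all? (λ v → (v ∈? A) →-dec ((v ∈? B) →-dec (no-⊥)))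
  where
  open import Relation.Nullary using (no)
  no-⊥ : Dec ⊥
  no-⊥ = no (λ ())

IsMatching : ∀ {r N} (G : MultiHypergraph r N) (t : ℕ) → Subset (m G) → Set
IsMatching G t S =
  (∣ S ∣ ≡ t) × (∀ i j → i ∈ S → j ∈ S → ¬ (i ≡ j) → Disjoint (edge G i) (edge G j))

IsMatching? : ∀ {r N} (G : MultiHypergraph r N) (t : ℕ) (S : Subset (m G)) → Dec (IsMatching G t S)
IsMatching? G t S =
  (∣ S ∣ ℕ.≟ t) ×-dec
  all? (λ i → all? (λ j → (i ∈? S) →-dec ((j ∈? S) →-dec ((¬? (i ≟ j)) →-dec Disjoint? (edge G i) (edge G j)))))

allSubsets : (n : ℕ) → List (Subset n)
allSubsets zero = [] ∷ []
allSubsets (suc n) = map (true ∷_) (allSubsets n) ++ map (false ∷_) (allSubsets n)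

numMatchings : ∀ {r N} (G : MultiHypergraph r N) (t : ℕ) → ℕ
numMatchings G t = length (filter (IsMatching? G t) (allSubsets (m G)))

_/2·_ : ℕ → (t : ℕ) → .{{_ : NonZero t}} → ℚ
_/2·_ e t = _/_ (+ e) (2 ℕ.* t) {{m*n≢0 2 t}}

{-# OPTIONS --safe #-}
module Submission where

-- Let every vertex lie on at most D + 1 edges of an r-uniform family of m edges. A matching of
-- size t + 1 either avoids the first edge E₀, or is E₀ together with a t-matching of edges
-- disjoint from E₀; and at most r·D other edges meet E₀, since each of its r vertices lies on at
-- most D of them. Pascal's rule and induction over the edges then give at least C(n, t + 1)
-- matchings of size t + 1 whenever n + t·r·D ≤ m. For matchings of size t, the hypotheses on Δ
-- and t give 2(t - 1)·r·Δ ≤ m through the handshake identity Σ deg = m·r, so with Δ = D + 1 one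
-- may take n with m ≤ 2(n - t + 1), and then t^t·C(n, t) ≥ (n - t + 1)^t ≥ (m/2)^t.

open import Defs

module _ where
  open import Data.Bool using (Bool; true; false; _∧_)
  open import Data.Fin using (Fin; zero; suc; _≟_)
  open import Data.Fin.Properties using (all?)
  open import Data.Fin.Subset using (Subset; _∈_; _⊆_; _∩_; ⊤; ∣_∣)
  open import Data.Fin.Subset.Properties
    using (_∈?_; _⊆?_; nonempty?; x∈p∩q⁺; x∈p∩q⁻; p⊆q⇒∣p∣≤∣q∣; ∣p∣≤∣x∷p∣; ∣⊤∣≡n; ∩-identityˡ)
  open import Data.List as List using ([]; _∷_; _++_; map; filter; length; foldr; allFin)
  open import Data.List.Properties using (filter-++; length-++; map-id; map-tabulate; filter-some)
  open import Data.List.Relation.Unary.Any using (here)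
  open import Data.Nat
    using (ℕ; zero; suc; _+_; _*_; _∸_; _^_; _⊔_; _≤_; z≤n; s≤s; s≤s⁻¹; NonZero; >-nonZero⁻¹)
    renaming (_≟_ to _≟ℕ_)
  open import Data.Nat.Combinatorics using (_C_; nC1≡n; nCk+nC[k+1]≡[n+1]C[k+1])
  import Data.Nat.ListAction as ListAction
  open import Data.Nat.Properties hiding (_≟_)
  open import Algebra.Properties.CommutativeSemigroup *-commutativeSemigroup using (x∙yz≈y∙xz)
  open import Algebra.Properties.Semiring.Sum +-*-semiring
    using (sum; sum-syntax; sum-cong-≗; sum-remove; ∑-comm; ∑-distrib-+; *-distribˡ-sum; *-distribʳ-sum)
  open import Data.Nat.Tactic.RingSolver using (solve-∀)
  open import Data.Product using (_×_; _,_; proj₁; proj₂; ∃-syntax)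
  open import Data.Vec using ([]; _∷_; lookup; tabulate; here; there)
  open import Data.Vec.Properties using (lookup∘tabulate; lookup-zipWith; []=⇒lookup; lookup⇒[]=)
  open import Function using (_∘_; id)
  open import Relation.Binary.PropositionalEquality
  open import Relation.Nullary using (Dec; yes; no; ¬_; does; contradiction)
  open import Relation.Nullary.Decidable using (_×-dec_; _→-dec_; ¬?; dec-true)
  open import Relation.Unary using (Pred; Decidable)

  𝟙 : Bool → ℕ
  𝟙 true  = 1
  𝟙 false = 0

  ∑-mono-≤ : ∀ {n} {f g : Fin n → ℕ} → (∀ i → f i ≤ g i) → sum f ≤ sum g
  ∑-mono-≤ {zero}  f≤g = z≤n
  ∑-mono-≤ {suc n} f≤g = +-mono-≤ (f≤g zero) (∑-mono-≤ (f≤g ∘ suc))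

  ∑-const : ∀ n c → ∑[ i < n ] c ≡ n * c
  ∑-const zero    c = refl
  ∑-const (suc n) c = cong (c +_) (∑-const n c)

  term≤∑ : ∀ {n} (f : Fin n → ℕ) i → f i ≤ sum f
  term≤∑ {suc n} f i = ≤-trans (m≤m+n (f i) _) (≤-reflexive (sym (sum-remove f)))

  sum-tabulate : ∀ {n} (f : Fin n → ℕ) → ListAction.sum (List.tabulate f) ≡ sum f
  sum-tabulate {zero}  f = refl
  sum-tabulate {suc n} f = cong (f zero +_) (sum-tabulate (f ∘ suc))

  sum-map-allFin : ∀ {n} (f : Fin n → ℕ) → ListAction.sum (map f (allFin n)) ≡ ∑[ i < n ] f i
  sum-map-allFin f = trans (cong ListAction.sum (map-tabulate id f)) (sum-tabulate f)

  term≤max-tabulate : ∀ {n} (f : Fin n → ℕ) i → f i ≤ foldr _⊔_ 0 (List.tabulate f)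
  term≤max-tabulate f zero    = m≤m⊔n (f zero) _
  term≤max-tabulate f (suc i) = ≤-trans (term≤max-tabulate (f ∘ suc) i) (m≤n⊔m (f zero) _)

  length-filter-map : ∀ {a b p q} {A : Set a} {B : Set b} {P : Pred B p} {Q : Pred A q}
                      (P? : Decidable P) (Q? : Decidable Q) (f : A → B) → (∀ {x} → Q x → P (f x)) →
                      ∀ xs → length (filter Q? xs) ≤ length (filter P? (map f xs))
  length-filter-map P? Q? f Q⇒P[f] []       = z≤n
  length-filter-map P? Q? f Q⇒P[f] (x ∷ xs) with Q? x | P? (f x)
  ... | yes _  | yes _   = s≤s (length-filter-map P? Q? f Q⇒P[f] xs)
  ... | yes qx | no ¬pfx = contradiction (Q⇒P[f] qx) ¬pfx
  ... | no _   | yes _   = m≤n⇒m≤1+n (length-filter-map P? Q? f Q⇒P[f] xs)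
  ... | no _   | no _    = length-filter-map P? Q? f Q⇒P[f] xs

  length-filter-++ : ∀ {a p} {A : Set a} {P : Pred A p} (P? : Decidable P) xs ys →
                     length (filter P? (xs ++ ys)) ≡ length (filter P? xs) + length (filter P? ys)
  length-filter-++ P? xs ys = trans (cong length (filter-++ P? xs ys)) (length-++ (filter P? xs))

  ∣p∣≡∑𝟙 : ∀ {n} (p : Subset n) → ∣ p ∣ ≡ ∑[ i < n ] 𝟙 (lookup p i)
  ∣p∣≡∑𝟙 []          = refl
  ∣p∣≡∑𝟙 (true  ∷ p) = cong suc (∣p∣≡∑𝟙 p)
  ∣p∣≡∑𝟙 (false ∷ p) = ∣p∣≡∑𝟙 p

  ∣p∩q∣≡∑𝟙 : ∀ {n} (p q : Subset n) → ∣ p ∩ q ∣ ≡ ∑[ i < n ] 𝟙 (lookup p i ∧ lookup q i)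
  ∣p∩q∣≡∑𝟙 p q = trans (∣p∣≡∑𝟙 (p ∩ q)) (sum-cong-≗ λ i → cong 𝟙 (lookup-zipWith _∧_ i p q))

  ∣p∩q∩r∣≤∣p∩r∣ : ∀ {n} (p q r : Subset n) → ∣ (p ∩ q) ∩ r ∣ ≤ ∣ p ∩ r ∣
  ∣p∩q∩r∣≤∣p∩r∣ p q r = p⊆q⇒∣p∣≤∣q∣ λ x∈pqr →
    let x∈pq , x∈r = x∈p∩q⁻ (p ∩ q) r x∈pqr in x∈p∩q⁺ (proj₁ (x∈p∩q⁻ p q x∈pq) , x∈r)

  does-∈?≡lookup : ∀ {n} (x : Fin n) (p : Subset n) → does (x ∈? p) ≡ lookup p x
  does-∈?≡lookup zero    (true  ∷ p) = refl
  does-∈?≡lookup zero    (false ∷ p) = refl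
  does-∈?≡lookup (suc x) (_ ∷ p)     = does-∈?≡lookup x p

  ¬Disjoint⇒common : ∀ {n} {X Y : Subset n} → ¬ Disjoint X Y → ∃[ v ] v ∈ X × v ∈ Y
  ¬Disjoint⇒common {X = X} {Y} ¬disjoint with nonempty? (X ∩ Y)
  ... | yes (v , v∈X∩Y) = v , x∈p∩q⁻ X Y v∈X∩Y
  ... | no  X∩Y-empty   =
    contradiction (λ v v∈X v∈Y → X∩Y-empty (v , x∈p∩q⁺ (v∈X , v∈Y))) ¬disjoint

  incident : ∀ {k N} → (Fin k → Subset N) → Fin N → Subset k
  incident E v = tabulate (λ i → does (v ∈? E i))

  avoiding : ∀ {k N} → Subset N → (Fin k → Subset N) → Subset k
  avoiding X E = tabulate (λ i → does (Disjoint? X (E i)))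

  lookup-incident : ∀ {k N} (E : Fin k → Subset N) v i → lookup (incident E v) i ≡ lookup (E i) v
  lookup-incident E v i = trans (lookup∘tabulate _ i) (does-∈?≡lookup v (E i))

  ∈tabulate-does⇒ : ∀ {k p} {P : Fin k → Set p} (P? : ∀ i → Dec (P i)) {i} → i ∈ tabulate (does ∘ P?) → P i
  ∈tabulate-does⇒ P? {i} i∈ with P? i | trans (sym (lookup∘tabulate (does ∘ P?) i)) ([]=⇒lookup i∈)
  ... | yes p | _  = p
  ... | no  _ | ()

  ∑∣incident∣≡∑∣edge∣ : ∀ {k N} (E : Fin k → Subset N) → ∑[ v < N ] ∣ incident E v ∣ ≡ ∑[ i < k ] ∣ E i ∣
  ∑∣incident∣≡∑∣edge∣ {k} {N} E = begin
    ∑[ v < N ] ∣ incident E v ∣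
      ≡⟨ sum-cong-≗ (λ v → ∣p∣≡∑𝟙 (incident E v)) ⟩
    ∑[ v < N ] ∑[ i < k ] 𝟙 (lookup (incident E v) i)
      ≡⟨ ∑-comm (λ v i → 𝟙 (lookup (incident E v) i)) ⟩
    ∑[ i < k ] ∑[ v < N ] 𝟙 (lookup (incident E v) i)
      ≡⟨ sum-cong-≗ (λ i → sum-cong-≗ λ v → cong 𝟙 (lookup-incident E v i)) ⟩
    ∑[ i < k ] ∑[ v < N ] 𝟙 (lookup (E i) v)
      ≡⟨ sum-cong-≗ (λ i → ∣p∣≡∑𝟙 (E i)) ⟨
    ∑[ i < k ] ∣ E i ∣
      ∎
    where open ≡-Reasoning

  meets-or-avoids : ∀ {N} (X Y : Subset N) a (disjoint? : Dec (Disjoint X Y)) →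
    𝟙 a ≤ 𝟙 (a ∧ does disjoint?) + ∑[ v < N ] (𝟙 (lookup X v) * 𝟙 (a ∧ lookup Y v))
  meets-or-avoids X Y false _                = z≤n
  meets-or-avoids X Y true  (yes _)          = s≤s z≤n
  meets-or-avoids X Y true  (no ¬disjoint) with v , v∈X , v∈Y ← ¬Disjoint⇒common ¬disjoint =
    subst (_≤ sum common) (cong₂ (λ x y → 𝟙 x * 𝟙 y) ([]=⇒lookup v∈X) ([]=⇒lookup v∈Y)) (term≤∑ common v)
    where common = λ u → 𝟙 (lookup X u) * 𝟙 (lookup Y u)

  -- An edge of A that does not avoid X is counted in the degree of some vertex of X.
  ∣A∣≤∣A∩avoiding∣+∑degree : ∀ {k N} (X : Subset N) (E : Fin k → Subset N) (A : Subset k) →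
    ∣ A ∣ ≤ ∣ A ∩ avoiding X E ∣ + ∑[ v < N ] (𝟙 (lookup X v) * ∣ A ∩ incident E v ∣)
  ∣A∣≤∣A∩avoiding∣+∑degree {k} {N} X E A = begin
    ∣ A ∣
      ≡⟨ ∣p∣≡∑𝟙 A ⟩
    ∑[ i < k ] 𝟙 (a i)
      ≤⟨ ∑-mono-≤ meets-or-avoids′ ⟩
    ∑[ i < k ] (avoids i + ∑[ v < N ] meets i v)
      ≡⟨ ∑-distrib-+ avoids (λ i → ∑[ v < N ] meets i v) ⟩
    ∑[ i < k ] avoids i + ∑[ i < k ] ∑[ v < N ] meets i v
      ≡⟨ cong₂ _+_ avoiding-part (∑-comm meets) ⟩
    ∣ A ∩ avoiding X E ∣ + ∑[ v < N ] ∑[ i < k ] meets i v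
      ≡⟨ cong (∣ A ∩ avoiding X E ∣ +_) (sum-cong-≗ incident-part) ⟩
    ∣ A ∩ avoiding X E ∣ + ∑[ v < N ] (𝟙 (x v) * ∣ A ∩ incident E v ∣)
      ∎
    where
    open ≤-Reasoning
    a = lookup A
    x = lookup X
    avoids = λ i → 𝟙 (a i ∧ does (Disjoint? X (E i)))
    meets  = λ i v → 𝟙 (x v) * 𝟙 (a i ∧ lookup (E i) v)
    meets-or-avoids′ : ∀ i → 𝟙 (a i) ≤ avoids i + ∑[ v < N ] meets i v
    meets-or-avoids′ i = meets-or-avoids X (E i) (a i) (Disjoint? X (E i))
    avoiding-part : ∑[ i < k ] avoids i ≡ ∣ A ∩ avoiding X E ∣
    avoiding-part = sym (trans (∣p∩q∣≡∑𝟙 A (avoiding X E)) (sum-cong-≗ λ i →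
      cong (λ b → 𝟙 (a i ∧ b)) (lookup∘tabulate (λ i → does (Disjoint? X (E i))) i)))
    incident-part : ∀ v → ∑[ i < k ] meets i v ≡ 𝟙 (x v) * ∣ A ∩ incident E v ∣
    incident-part v = trans (sym (*-distribˡ-sum (𝟙 (x v)) (λ i → 𝟙 (a i ∧ lookup (E i) v))))
      (cong (𝟙 (x v) *_) (sym (trans (∣p∩q∣≡∑𝟙 A (incident E v)) (sum-cong-≗ λ i →
        cong (λ b → 𝟙 (a i ∧ b)) (lookup-incident E v i)))))

  ∑𝟙*≤∣∣* : ∀ {N} (X : Subset N) (f : Fin N → ℕ) {D} → (∀ v → v ∈ X → f v ≤ D) →
    ∑[ v < N ] (𝟙 (lookup X v) * f v) ≤ ∣ X ∣ * D
  ∑𝟙*≤∣∣* {N} X f {D} f≤D = begin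
    ∑[ v < N ] (𝟙 (lookup X v) * f v)  ≤⟨ ∑-mono-≤ bound ⟩
    ∑[ v < N ] (𝟙 (lookup X v) * D)    ≡⟨ *-distribʳ-sum D (𝟙 ∘ lookup X) ⟨
    (∑[ v < N ] 𝟙 (lookup X v)) * D    ≡⟨ cong (_* D) (∣p∣≡∑𝟙 X) ⟨
    ∣ X ∣ * D                           ∎
    where
    open ≤-Reasoning
    bound : ∀ v → 𝟙 (lookup X v) * f v ≤ 𝟙 (lookup X v) * D
    bound v with lookup X v in eq
    ... | true  = *-monoʳ-≤ 1 (f≤D v (lookup⇒[]= v X eq))
    ... | false = z≤n

  PairwiseDisjoint : ∀ {k N} → (Fin k → Subset N) → Subset k → Set
  PairwiseDisjoint E S = ∀ i j → i ∈ S → j ∈ S → ¬ i ≡ j → Disjoint (E i) (E j)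

  pairwiseDisjoint? : ∀ {k N} (E : Fin k → Subset N) → Decidable (PairwiseDisjoint E)
  pairwiseDisjoint? E S =
    all? λ i → all? λ j → i ∈? S →-dec j ∈? S →-dec ¬? (i ≟ j) →-dec Disjoint? (E i) (E j)

  MatchingWithin : ∀ {k N} → (Fin k → Subset N) → Subset k → ℕ → Subset k → Set
  MatchingWithin E A t S = ∣ S ∣ ≡ t × S ⊆ A × PairwiseDisjoint E S

  matchingWithin? : ∀ {k N} (E : Fin k → Subset N) A t → Decidable (MatchingWithin E A t)
  matchingWithin? E A t S = ∣ S ∣ ≟ℕ t ×-dec S ⊆? A ×-dec pairwiseDisjoint? E S

  matchingsWithin : ∀ {k N} → (Fin k → Subset N) → Subset k → ℕ → ℕ
  matchingsWithin {k} E A t = length (filter (matchingWithin? E A t) (allSubsets k))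

  module _ {k N} {E : Fin (suc k) → Subset N} where

    false∷-matchingWithin : ∀ {a A t S} → MatchingWithin (E ∘ suc) A t S → MatchingWithin E (a ∷ A) t (false ∷ S)
    false∷-matchingWithin (∣S∣≡t , S⊆A , disjoint) =
        ∣S∣≡t
      , (λ { (there i∈S) → there (S⊆A i∈S) })
      , λ { (suc i) (suc j) (there i∈S) (there j∈S) i≢j → disjoint i j i∈S j∈S (i≢j ∘ cong suc) }

    true∷-matchingWithin : ∀ {A t S} → MatchingWithin (E ∘ suc) (A ∩ avoiding (E zero) (E ∘ suc)) t S →
                           MatchingWithin E (true ∷ A) (suc t) (true ∷ S)
    true∷-matchingWithin {A} {S = S} (∣S∣≡t , S⊆A∩avoiding , disjoint) = cong suc ∣S∣≡t , ⊆true∷A , disjoint′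
      where
      avoids-E₀ : ∀ {j} → j ∈ S → Disjoint (E zero) (E (suc j))
      avoids-E₀ j∈S = ∈tabulate-does⇒ (λ j → Disjoint? (E zero) (E (suc j)))
                                      (proj₂ (x∈p∩q⁻ A _ (S⊆A∩avoiding j∈S)))
      ⊆true∷A : (true ∷ S) ⊆ (true ∷ A)
      ⊆true∷A here        = here
      ⊆true∷A (there j∈S) = there (proj₁ (x∈p∩q⁻ A _ (S⊆A∩avoiding j∈S)))
      disjoint′ : PairwiseDisjoint E (true ∷ S)
      disjoint′ zero    zero    _           _           0≢0 = contradiction refl 0≢0
      disjoint′ zero    (suc j) _           (there j∈S) _   = avoids-E₀ j∈S
      disjoint′ (suc i) zero    (there i∈S) _           _   = λ v v∈Eᵢ v∈E₀ → avoids-E₀ i∈S v v∈E₀ v∈Eᵢ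
      disjoint′ (suc i) (suc j) (there i∈S) (there j∈S) i≢j = disjoint i j i∈S j∈S (i≢j ∘ cong suc)

    matchingsWithin-∷ : ∀ a A t → matchingsWithin E (a ∷ A) t ≡
      length (filter (matchingWithin? E (a ∷ A) t) (map (true ∷_) (allSubsets k))) +
      length (filter (matchingWithin? E (a ∷ A) t) (map (false ∷_) (allSubsets k)))
    matchingsWithin-∷ a A t = length-filter-++ (matchingWithin? E (a ∷ A) t)
                                                (map (true ∷_) (allSubsets k)) (map (false ∷_) (allSubsets k))

    matchingsWithin-skip : ∀ a A t → matchingsWithin (E ∘ suc) A t ≤ matchingsWithin E (a ∷ A) t
    matchingsWithin-skip a A t = begin
      matchingsWithin (E ∘ suc) A t
        ≤⟨ length-filter-map _ (matchingWithin? (E ∘ suc) A t) (false ∷_) false∷-matchingWithin (allSubsets k) ⟩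
      length (filter (matchingWithin? E (a ∷ A) t) (map (false ∷_) (allSubsets k)))
        ≤⟨ m≤n+m _ _ ⟩
      _ ≡⟨ matchingsWithin-∷ a A t ⟨
      matchingsWithin E (a ∷ A) t ∎
      where open ≤-Reasoning

    matchingsWithin-split : ∀ A t →
      matchingsWithin (E ∘ suc) (A ∩ avoiding (E zero) (E ∘ suc)) t + matchingsWithin (E ∘ suc) A (suc t)
        ≤ matchingsWithin E (true ∷ A) (suc t)
    matchingsWithin-split A t = begin
      matchingsWithin (E ∘ suc) (A ∩ avoiding (E zero) (E ∘ suc)) t + matchingsWithin (E ∘ suc) A (suc t)
        ≤⟨ +-mono-≤ (length-filter-map _ _ (true ∷_) true∷-matchingWithin (allSubsets k))
                    (length-filter-map _ _ (false ∷_) false∷-matchingWithin (allSubsets k)) ⟩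
      _ ≡⟨ matchingsWithin-∷ true A (suc t) ⟨
      matchingsWithin E (true ∷ A) (suc t) ∎
      where open ≤-Reasoning

  matchingsWithin-zero : ∀ {k N} (E : Fin k → Subset N) A → 1 ≤ matchingsWithin E A 0
  matchingsWithin-zero {zero}  E []      =
    filter-some (matchingWithin? E [] 0) {[] ∷ []} (here (refl , id , λ ()))
  matchingsWithin-zero {suc k} E (a ∷ A) =
    ≤-trans (matchingsWithin-zero (E ∘ suc) A) (matchingsWithin-skip a A 0)

  ∣A∣≤∣A∩avoiding∣+r*D : ∀ {k N r D} (E : Fin (suc k) → Subset N) → ∣ E zero ∣ ≡ r → ∀ A →
    (∀ v → ∣ (true ∷ A) ∩ incident E v ∣ ≤ suc D) → ∣ A ∣ ≤ ∣ A ∩ avoiding (E zero) (E ∘ suc) ∣ + r * D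
  ∣A∣≤∣A∩avoiding∣+r*D {D = D} E ∣E₀∣≡r A degree≤ =
    ≤-trans (∣A∣≤∣A∩avoiding∣+∑degree (E zero) (E ∘ suc) A)
            (+-monoʳ-≤ _ (subst (λ x → _ ≤ x * D) ∣E₀∣≡r (∑𝟙*≤∣∣* (E zero) _ degree-on-E₀)))
    where
    degree-on-E₀ : ∀ v → v ∈ E zero → ∣ A ∩ incident (E ∘ suc) v ∣ ≤ D
    degree-on-E₀ v v∈E₀ = s≤s⁻¹ (subst (λ b → ∣ b ∷ (A ∩ incident (E ∘ suc) v) ∣ ≤ suc D)
                                       (dec-true (v ∈? E zero) v∈E₀) (degree≤ v))

  matchingsWithin-lower-bound : ∀ {k N r D} (E : Fin k → Subset N) → (∀ i → ∣ E i ∣ ≡ r) →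
    ∀ A → (∀ v → ∣ A ∩ incident E v ∣ ≤ suc D) →
    ∀ t n → n + t * (r * D) ≤ ∣ A ∣ → n C suc t ≤ matchingsWithin E A (suc t)
  matchingsWithin-lower-bound E uniform [] degree≤ t zero _ = z≤n
  matchingsWithin-lower-bound E uniform (false ∷ A) degree≤ t n n+tc≤∣A∣ =
    ≤-trans (matchingsWithin-lower-bound (E ∘ suc) (uniform ∘ suc) A degree≤ t n n+tc≤∣A∣)
            (matchingsWithin-skip false A (suc t))
  matchingsWithin-lower-bound E uniform (true ∷ A) degree≤ t zero _ = z≤n
  matchingsWithin-lower-bound {r = r} {D} E uniform (true ∷ A) degree≤ t (suc n) (s≤s n+tc≤∣A∣) = begin
    suc n C suc t                                            ≡⟨ nCk+nC[k+1]≡[n+1]C[k+1] n t ⟨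
    n C t + n C suc t                                        ≤⟨ +-mono-≤ (using-E₀ t n+tc≤∣A∣) avoiding-E₀ ⟩
    matchingsWithin E′ A′ t + matchingsWithin E′ A (suc t)   ≤⟨ matchingsWithin-split A t ⟩
    matchingsWithin E (true ∷ A) (suc t)                     ∎
    where
    open ≤-Reasoning
    E′ = E ∘ suc
    A′ = A ∩ avoiding (E zero) E′
    c = r * D
    degree≤′ : ∀ v → ∣ A ∩ incident E′ v ∣ ≤ suc D
    degree≤′ v = ≤-trans (∣p∣≤∣x∷p∣ (does (v ∈? E zero)) (A ∩ incident E′ v)) (degree≤ v)
    avoiding-E₀ : n C suc t ≤ matchingsWithin E′ A (suc t)
    avoiding-E₀ = matchingsWithin-lower-bound E′ (uniform ∘ suc) A degree≤′ t n n+tc≤∣A∣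
    using-E₀ : ∀ t → n + t * c ≤ ∣ A ∣ → n C t ≤ matchingsWithin E′ A′ t
    using-E₀ zero    _           = matchingsWithin-zero E′ A′
    using-E₀ (suc t) n+c+tc≤∣A∣ =
      matchingsWithin-lower-bound E′ (uniform ∘ suc) A′
                                  (λ v → ≤-trans (∣p∩q∩r∣≤∣p∩r∣ A _ _) (degree≤′ v)) t n
        (+-cancelʳ-≤ c _ _ (begin
          n + t * c + c     ≡⟨ trans (+-assoc n _ c) (cong (n +_) (+-comm _ c)) ⟩
          n + (c + t * c)   ≤⟨ n+c+tc≤∣A∣ ⟩
          ∣ A ∣             ≤⟨ ∣A∣≤∣A∩avoiding∣+r*D E (uniform zero) A degree≤ ⟩
          ∣ A′ ∣ + c        ∎))

  [k+1]*[n+1]C[k+1]≡[n+1]*nCk : ∀ n k → suc k * (suc n C suc k) ≡ suc n * (n C k)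
  [k+1]*[n+1]C[k+1]≡[n+1]*nCk n       zero    =
    trans (*-identityˡ (suc n C 1)) (trans (nC1≡n (suc n)) (sym (*-identityʳ (suc n))))
  [k+1]*[n+1]C[k+1]≡[n+1]*nCk zero    (suc k) = *-zeroʳ (suc (suc k))
  [k+1]*[n+1]C[k+1]≡[n+1]*nCk (suc n) (suc k) = begin
    suc (suc k) * (suc (suc n) C suc (suc k))
      ≡⟨ cong (suc (suc k) *_) (nCk+nC[k+1]≡[n+1]C[k+1] (suc n) (suc k)) ⟨
    suc (suc k) * (P + Q)
      ≡⟨ *-distribˡ-+ (suc (suc k)) P Q ⟩
    P + suc k * P + suc (suc k) * Q
      ≡⟨ +-assoc P (suc k * P) (suc (suc k) * Q) ⟩
    P + (suc k * P + suc (suc k) * Q)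
      ≡⟨ cong (P +_) (cong₂ _+_ ([k+1]*[n+1]C[k+1]≡[n+1]*nCk n k) ([k+1]*[n+1]C[k+1]≡[n+1]*nCk n (suc k))) ⟩
    P + (suc n * (n C k) + suc n * (n C suc k))
      ≡⟨ cong (P +_) (*-distribˡ-+ (suc n) (n C k) (n C suc k)) ⟨
    P + suc n * (n C k + n C suc k)
      ≡⟨ cong (λ x → P + suc n * x) (nCk+nC[k+1]≡[n+1]C[k+1] n k) ⟩
    suc (suc n) * P
      ∎
    where
    open ≡-Reasoning
    P = suc n C suc k
    Q = suc n C suc (suc k)

  [1+k]^t≤t^t*[k+t]Ct : ∀ k t → suc k ^ t ≤ t ^ t * ((k + t) C t)
  [1+k]^t≤t^t*[k+t]Ct k zero    = ≤-refl
  [1+k]^t≤t^t*[k+t]Ct k (suc t) = begin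
    suc k * suc k ^ t
      ≤⟨ *-monoʳ-≤ (suc k) ([1+k]^t≤t^t*[k+t]Ct k t) ⟩
    suc k * (t ^ t * ((k + t) C t))
      ≡⟨ x∙yz≈y∙xz (suc k) (t ^ t) ((k + t) C t) ⟩
    t ^ t * (suc k * ((k + t) C t))
      ≤⟨ *-mono-≤ (^-monoˡ-≤ t (n≤1+n t)) (*-monoˡ-≤ ((k + t) C t) (s≤s (m≤m+n k t))) ⟩
    suc t ^ t * (suc (k + t) * ((k + t) C t))
      ≡⟨ cong (suc t ^ t *_) ([k+1]*[n+1]C[k+1]≡[n+1]*nCk (k + t) t) ⟨
    suc t ^ t * (suc t * (suc (k + t) C suc t))
      ≡⟨ x∙yz≈y∙xz (suc t ^ t) (suc t) (suc (k + t) C suc t) ⟩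
    suc t * (suc t ^ t * (suc (k + t) C suc t))
      ≡⟨ *-assoc (suc t) (suc t ^ t) (suc (k + t) C suc t) ⟨
    suc t ^ suc t * (suc (k + t) C suc t)
      ≡⟨ cong (λ n → suc t ^ suc t * (n C suc t)) (+-suc k t) ⟨
    suc t ^ suc t * ((k + suc t) C suc t)
      ∎
    where open ≤-Reasoning

  ^-distribʳ-* : ∀ m n o → (m * n) ^ o ≡ m ^ o * n ^ o
  ^-distribʳ-* m n zero    = refl
  ^-distribʳ-* m n (suc o) = trans (cong (m * n *_) (^-distribʳ-* m n o)) ([m*n]*[o*p]≡[m*o]*[n*p] m n _ _)

  m^t≤[2t]^t*[k+t]Ct : ∀ {m k} t → m ≤ 2 * suc k → m ^ t ≤ (2 * t) ^ t * ((k + t) C t)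
  m^t≤[2t]^t*[k+t]Ct {m} {k} t m≤2[1+k] = begin
    m ^ t                              ≤⟨ ^-monoˡ-≤ t m≤2[1+k] ⟩
    (2 * suc k) ^ t                    ≡⟨ ^-distribʳ-* 2 (suc k) t ⟩
    2 ^ t * suc k ^ t                  ≤⟨ *-monoʳ-≤ (2 ^ t) ([1+k]^t≤t^t*[k+t]Ct k t) ⟩
    2 ^ t * (t ^ t * ((k + t) C t))    ≡⟨ *-assoc (2 ^ t) (t ^ t) ((k + t) C t) ⟨
    2 ^ t * t ^ t * ((k + t) C t)      ≡⟨ cong (_* ((k + t) C t)) (^-distribʳ-* 2 t t) ⟨
    (2 * t) ^ t * ((k + t) C t)        ∎
    where open ≤-Reasoning

  m^[1+t]≤[2+2t]^[1+t]*M : ∀ t a {m M} → 2 * (t + a) ≤ m → (∀ n → n + a ≤ m → n C suc t ≤ M) →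
                               m ^ suc t ≤ (2 * suc t) ^ suc t * M
  m^[1+t]≤[2+2t]^[1+t]*M t a {m} {M} 2b≤m C≤M = split (m ∸ b) (m∸n+n≡m b≤m) (m+n≤o⇒m≤o∸n b b+b≤m)
    where
    open ≤-Reasoning
    b = t + a
    b+b≤m : b + b ≤ m
    b+b≤m = subst (_≤ m) (cong (b +_) (+-identityʳ b)) 2b≤m
    b≤m : b ≤ m
    b≤m = m+n≤o⇒n≤o b b+b≤m
    rearrange : ∀ k t a → k + suc t + a ≡ suc k + (t + a)
    rearrange = solve-∀
    -- j = m - (t + a); for j = k + 1 the binomial C(k + t + 1, t + 1) is admissible and m ≤ 2(k + 1).
    split : ∀ j → j + b ≡ m → b ≤ j → m ^ suc t ≤ (2 * suc t) ^ suc t * M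
    split zero    b≡m b≤0 = subst (λ x → x ^ suc t ≤ _) (trans (sym (n≤0⇒n≡0 b≤0)) b≡m) z≤n
    split (suc k) j+b≡m b≤j = subst (λ x → x ^ suc t ≤ (2 * suc t) ^ suc t * M) j+b≡m (begin
      (suc k + b) ^ suc t                          ≤⟨ m^t≤[2t]^t*[k+t]Ct (suc t) 1+k+b≤2[1+k] ⟩
      (2 * suc t) ^ suc t * ((k + suc t) C suc t)  ≤⟨ *-monoʳ-≤ ((2 * suc t) ^ suc t) (C≤M (k + suc t) n+a≤m) ⟩
      (2 * suc t) ^ suc t * M                      ∎)
      where
      1+k+b≤2[1+k] : suc k + b ≤ 2 * suc k
      1+k+b≤2[1+k] = subst (suc k + b ≤_) (cong (suc k +_) (sym (+-identityʳ (suc k)))) (+-monoʳ-≤ (suc k) b≤j)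
      n+a≤m : k + suc t + a ≤ m
      n+a≤m = ≤-reflexive (trans (rearrange k t a) j+b≡m)

  2*[t*[r*Δ]]≤m : ∀ t r Δ m P Q N .{{_ : NonZero r}} .{{_ : NonZero P}} .{{_ : NonZero Q}} .{{_ : NonZero N}} →
                  Δ * (Q * N) ≤ P * (m * r) → t * (2 * (r * r) * P) ≤ N * Q → 2 * (t * (r * Δ)) ≤ m
  2*[t*[r*Δ]]≤m t r Δ m P Q N Δ-bound t-bound =
    *-cancelʳ-≤ (2 * (t * (r * Δ))) m (r * P * Q * N) {{rPQN≢0}}
      (subst₂ _≤_ (lhs t r Δ P Q N) (rhs N Q P m r) (*-mono-≤ t-bound Δ-bound))
    where
    lhs : ∀ t r Δ P Q N → t * (2 * (r * r) * P) * (Δ * (Q * N)) ≡ 2 * (t * (r * Δ)) * (r * P * Q * N)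
    lhs = solve-∀
    rhs : ∀ N Q P m r → N * Q * (P * (m * r)) ≡ m * (r * P * Q * N)
    rhs = solve-∀
    rPQN≢0 : NonZero (r * P * Q * N)
    rPQN≢0 = m*n≢0 (r * P * Q) N {{m*n≢0 (r * P) Q {{m*n≢0 r P}}}}

  module _ {r N} (G : MultiHypergraph r N) where

    degree≤Δ : ∀ v → degree G v ≤ Δ G
    degree≤Δ v = subst (degree G v ≤_) (cong (foldr _⊔_ 0) (sym (map-tabulate id (degree G))))
                       (term≤max-tabulate (degree G) v)

    ∑degree≡e*r : ∑[ v < N ] degree G v ≡ e G * r
    ∑degree≡e*r = begin
      ∑[ v < N ] degree G v        ≡⟨ ∑∣incident∣≡∑∣edge∣ (edge G) ⟩
      ∑[ i < e G ] ∣ edge G i ∣    ≡⟨ sum-cong-≗ (uniform G) ⟩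
      ∑[ i < e G ] r               ≡⟨ ∑-const (e G) r ⟩
      e G * r                      ∎
      where open ≡-Reasoning

    sum-degrees≡e*r : ListAction.sum (map (degree G) (allFin N)) ≡ e G * r
    sum-degrees≡e*r = trans (sum-map-allFin (degree G)) ∑degree≡e*r

    e*r≤N*Δ : e G * r ≤ N * Δ G
    e*r≤N*Δ = begin
      e G * r                ≡⟨ ∑degree≡e*r ⟨
      ∑[ v < N ] degree G v  ≤⟨ ∑-mono-≤ degree≤Δ ⟩
      ∑[ v < N ] Δ G         ≡⟨ ∑-const N (Δ G) ⟩
      N * Δ G                ∎
      where open ≤-Reasoning

    Δ≡0⇒e≡0 : .{{_ : NonZero r}} → Δ G ≡ 0 → e G ≡ 0
    Δ≡0⇒e≡0 Δ≡0 = n≤0⇒n≡0 (*-cancelʳ-≤ (e G) 0 r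
      (≤-trans e*r≤N*Δ (≤-reflexive (trans (cong (N *_) Δ≡0) (*-zeroʳ N)))))

    matchingsWithin⊤≤numMatchings : ∀ t → matchingsWithin (edge G) ⊤ t ≤ numMatchings G t
    matchingsWithin⊤≤numMatchings t =
      subst (matchingsWithin (edge G) ⊤ t ≤_)
            (cong (length ∘ filter (IsMatching? G t)) (map-id (allSubsets (e G))))
            (length-filter-map (IsMatching? G t) (matchingWithin? (edge G) ⊤ t) id
                               (λ (∣S∣≡t , _ , disjoint) → ∣S∣≡t , disjoint) (allSubsets (e G)))

    numMatchings-lower-bound : .{{_ : NonZero r}} → ∀ t → 2 * (t * (r * Δ G)) ≤ e G →
                               e G ^ suc t ≤ (2 * suc t) ^ suc t * numMatchings G (suc t)
    numMatchings-lower-bound t 2tr∆≤e with Δ G in Δ≡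
    ... | zero  = subst (λ m → m ^ suc t ≤ (2 * suc t) ^ suc t * numMatchings G (suc t))
                        (sym (Δ≡0⇒e≡0 Δ≡)) z≤n
    ... | suc D = m^[1+t]≤[2+2t]^[1+t]*M t (t * (r * D))
                    (≤-trans (*-monoʳ-≤ 2 t+trD≤tr[1+D]) 2tr∆≤e) matchings
      where
      t+trD≤tr[1+D] : t + t * (r * D) ≤ t * (r * suc D)
      t+trD≤tr[1+D] = begin
        t + t * (r * D)    ≡⟨ *-suc t (r * D) ⟨
        t * suc (r * D)    ≤⟨ *-monoʳ-≤ t (+-monoˡ-≤ (r * D) (>-nonZero⁻¹ r)) ⟩
        t * (r + r * D)    ≡⟨ cong (t *_) (*-suc r D) ⟨
        t * (r * suc D)    ∎
        where open ≤-Reasoning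
      degree≤ : ∀ v → ∣ ⊤ ∩ incident (edge G) v ∣ ≤ suc D
      degree≤ v = subst (λ S → ∣ S ∣ ≤ suc D) (sym (∩-identityˡ (incident (edge G) v)))
                        (subst (degree G v ≤_) Δ≡ (degree≤Δ v))
      matchings : ∀ n → n + t * (r * D) ≤ e G → n C suc t ≤ numMatchings G (suc t)
      matchings n n+trD≤e = ≤-trans
        (matchingsWithin-lower-bound (edge G) (uniform G) ⊤ degree≤ t n
                                     (subst (n + t * (r * D) ≤_) (sym (∣⊤∣≡n (e G))) n+trD≤e))
        (matchingsWithin⊤≤numMatchings (suc t))

module _ where
  open import Data.Integer as ℤ using (+_; +≤+)
  open import Data.Integer.Properties using (pos-*; pos-+; drop‿+≤+)
  open import Data.Nat using (ℕ; zero; suc; _+_; _*_; _^_; _≤_; NonZero)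
  open import Data.Nat.Properties using (*-comm; *-identityʳ; +-cancelʳ-≤; m*n≢0; m^n≢0)
  open import Data.Nat.Tactic.RingSolver using (solve-∀)
  open import Data.Rational as ℚ using (ℚ; mkℚ; toℚᵘ)
  open import Data.Rational.Properties
    using (toℚᵘ-fromℚᵘ; toℚᵘ-mono-≤; toℚᵘ-cancel-≤; toℚᵘ-homo-*; toℚᵘ-homo-+)
  open import Data.Rational.Unnormalised as ℚᵘ using (ℚᵘ; mkℚᵘ; *≤*; _≃_)
  open import Data.Rational.Unnormalised.Properties
    using (≤-respˡ-≃; ≤-respʳ-≃; ≃-trans; ≃-sym; ≃-refl; ≃-reflexive; *-cong; +-cong)
  open import Relation.Binary.PropositionalEquality

  -- Inequalities are transported to ℚᵘ, where a ÷ b has numerator a and denominator b exactly.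
  infix 8 _÷_
  _÷_ : ℕ → (b : ℕ) → .{{NonZero b}} → ℚᵘ
  a ÷ b = + a ℚᵘ./ b

  toℚᵘ-/ : ∀ a b .{{_ : NonZero b}} → toℚᵘ (+ a ℚ./ b) ≃ a ÷ b
  toℚᵘ-/ a (suc b) = toℚᵘ-fromℚᵘ (mkℚᵘ (+ a) b)

  ÷-*-÷ : ∀ a b c d .{{_ : NonZero b}} .{{_ : NonZero d}} →
          a ÷ b ℚᵘ.* c ÷ d ≃ _÷_ (a * c) (b * d) {{m*n≢0 b d}}
  ÷-*-÷ a (suc b) c (suc d) = ≃-reflexive (cong (λ n → mkℚᵘ n (d + b * suc d)) (sym (pos-* a c)))

  ÷-+-÷ : ∀ a b c d .{{_ : NonZero b}} .{{_ : NonZero d}} →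
          a ÷ b ℚᵘ.+ c ÷ d ≃ _÷_ (a * d + c * b) (b * d) {{m*n≢0 b d}}
  ÷-+-÷ a (suc b) c (suc d) = ≃-reflexive (cong (λ n → mkℚᵘ n (d + b * suc d))
    (trans (cong₂ ℤ._+_ (sym (pos-* a (suc d))) (sym (pos-* c (suc b))))
           (sym (pos-+ (a * suc d) (c * suc b)))))

  ÷≤÷⇒*≤* : ∀ a b c d .{{_ : NonZero b}} .{{_ : NonZero d}} → a ÷ b ℚᵘ.≤ c ÷ d → a * d ≤ c * b
  ÷≤÷⇒*≤* a (suc b) c (suc d) (*≤* ad≤cb)
    rewrite sym (pos-* a (suc d)) | sym (pos-* c (suc b)) = drop‿+≤+ ad≤cb

  *≤*⇒÷≤÷ : ∀ a b c d .{{_ : NonZero b}} .{{_ : NonZero d}} → a * d ≤ c * b → a ÷ b ℚᵘ.≤ c ÷ d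
  *≤*⇒÷≤÷ a (suc b) c (suc d) ad≤cb = *≤* (subst₂ ℤ._≤_ (pos-* a (suc d)) (pos-* c (suc b)) (+≤+ ad≤cb))

  toℚᵘ-^ℚ : ∀ a b t .{{_ : NonZero b}} → toℚᵘ ((+ a ℚ./ b) ^ℚ t) ≃ _÷_ (a ^ t) (b ^ t) {{m^n≢0 b t}}
  toℚᵘ-^ℚ a b zero    = ≃-refl
  toℚᵘ-^ℚ a b (suc t) = ≃-trans (toℚᵘ-homo-* (+ a ℚ./ b) ((+ a ℚ./ b) ^ℚ t))
    (≃-trans (*-cong (toℚᵘ-/ a b) (toℚᵘ-^ℚ a b t)) (÷-*-÷ a b (a ^ t) (b ^ t) {{_}} {{m^n≢0 b t}}))

  ≤μ*[S/N]-cleared : ∀ a S N .{{_ : NonZero N}} (μ : ℚ) .{{_ : ℚ.Positive μ}} →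
                     ℕ→ℚ a ℚ.≤ μ ℚ.* (+ S ℚ./ N) → a * (ℚ.↧ₙ μ * N) ≤ ℤ.∣ ℚ.↥ μ ∣ * S
  ≤μ*[S/N]-cleared a S N@(suc _) μ@(mkℚ (+ suc p) q _) a≤μS/N =
    subst (a * (suc q * N) ≤_) (*-identityʳ (suc p * S)) (÷≤÷⇒*≤* a 1 (suc p * S) (suc q * N)
      (≤-respˡ-≃ (toℚᵘ-/ a 1) (≤-respʳ-≃ μS/N≃ (toℚᵘ-mono-≤ a≤μS/N))))
    where
    μS/N≃ : toℚᵘ (μ ℚ.* (+ S ℚ./ N)) ≃ (suc p * S) ÷ (suc q * N)
    μS/N≃ = ≃-trans (toℚᵘ-homo-* μ (+ S ℚ./ N))
                    (≃-trans (*-cong ≃-refl (toℚᵘ-/ S N)) (÷-*-÷ (suc p) (suc q) S N))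

  ≤tBound-cleared : ∀ t N r .{{_ : NonZero r}} (μ : ℚ) .{{_ : ℚ.Positive μ}} →
                    ℕ→ℚ (suc t) ℚ.≤ tBound N r μ → t * (2 * (r * r) * ℤ.∣ ℚ.↥ μ ∣) ≤ N * ℚ.↧ₙ μ
  ≤tBound-cleared t N r@(suc _) μ@(mkℚ (+ suc p) q _) 1+t≤bound =
    +-cancelʳ-≤ (R * P) (t * (R * P)) (N * Q) (subst₂ _≤_ (lhs t (R * P)) (rhs (N * Q) (R * P))
      (÷≤÷⇒*≤* (suc t) 1 (N * Q * 1 + 1 * (R * P)) (R * P * 1)
        (≤-respˡ-≃ (toℚᵘ-/ (suc t) 1) (≤-respʳ-≃ bound≃ (toℚᵘ-mono-≤ 1+t≤bound)))))
    where
    P = suc p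
    Q = suc q
    R = 2 * (r * r)
    N/R*1/μ≃ : toℚᵘ (+ N ℚ./ R ℚ.* ℚ.1/ μ) ≃ (N * Q) ÷ (R * P)
    N/R*1/μ≃ = ≃-trans (toℚᵘ-homo-* (+ N ℚ./ R) (ℚ.1/ μ))
                       (≃-trans (*-cong (toℚᵘ-/ N R) ≃-refl) (÷-*-÷ N R Q P))
    bound≃ : toℚᵘ (tBound N r μ) ≃ (N * Q * 1 + 1 * (R * P)) ÷ (R * P * 1)
    bound≃ = ≃-trans (toℚᵘ-homo-+ (+ N ℚ./ R ℚ.* ℚ.1/ μ) ℚ.1ℚ)
                     (≃-trans (+-cong N/R*1/μ≃ ≃-refl) (÷-+-÷ (N * Q) (R * P) 1 1))
    lhs : ∀ t x → suc t * (x * 1) ≡ t * x + x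
    lhs = solve-∀
    rhs : ∀ y x → (y * 1 + 1 * x) * 1 ≡ y + x
    rhs = solve-∀

  Δ≤μd-cleared : ∀ {r N} .{{_ : NonZero N}} (G : MultiHypergraph r N) (μ : ℚ) .{{_ : ℚ.Positive μ}} →
                 ℕ→ℚ (Δ G) ℚ.≤ μ ℚ.* d G → Δ G * (ℚ.↧ₙ μ * N) ≤ ℤ.∣ ℚ.↥ μ ∣ * (e G * r)
  Δ≤μd-cleared {N = N} G μ Δ≤μd = subst (λ S → Δ G * (ℚ.↧ₙ μ * N) ≤ ℤ.∣ ℚ.↥ μ ∣ * S)
                                        (sum-degrees≡e*r G) (≤μ*[S/N]-cleared (Δ G) _ N μ Δ≤μd)

  2*[t*[r*Δ]]≤e : ∀ {r N} .{{_ : NonZero r}} .{{_ : NonZero N}} (G : MultiHypergraph r N)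
                  (μ : ℚ) .{{_ : ℚ.Positive μ}} t → ℕ→ℚ (Δ G) ℚ.≤ μ ℚ.* d G →
                  ℕ→ℚ (suc t) ℚ.≤ tBound N r μ → 2 * (t * (r * Δ G)) ≤ e G
  2*[t*[r*Δ]]≤e {r} {N} G μ@(mkℚ (+ suc p) q _) t Δ≤μd 1+t≤bound =
    2*[t*[r*Δ]]≤m t r (Δ G) (e G) (suc p) (suc q) N
                  (Δ≤μd-cleared G μ Δ≤μd) (≤tBound-cleared t N r μ 1+t≤bound)

  m^t≤[2t]^t*M⇒[m/2t]^t≤M : ∀ m t .{{_ : NonZero t}} M →
                             m ^ t ≤ (2 * t) ^ t * M → (m /2· t) ^ℚ t ℚ.≤ ℕ→ℚ M
  m^t≤[2t]^t*M⇒[m/2t]^t≤M m t@(suc _) M m^t≤[2t]^tM = toℚᵘ-cancel-≤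
    (≤-respˡ-≃ (≃-sym (toℚᵘ-^ℚ m (2 * t) t)) (≤-respʳ-≃ (≃-sym (toℚᵘ-/ M 1))
      (*≤*⇒÷≤÷ (m ^ t) ((2 * t) ^ t) M 1 {{m^n≢0 (2 * t) t}}
        (subst₂ _≤_ (sym (*-identityʳ (m ^ t))) (*-comm ((2 * t) ^ t) M) m^t≤[2t]^tM))))

open import Data.Nat using (ℕ; suc; NonZero)
open import Data.Rational using (ℚ; _≤_; _*_; Positive)

lemma3p7 : (r : ℕ) .{{_ : NonZero r}} (μ : ℚ) .{{_ : Positive μ}}
    (N : ℕ) .{{_ : NonZero N}} (G : MultiHypergraph r N) →
    ℕ→ℚ (Δ G) ≤ μ * d G →
    (t : ℕ) .{{_ : NonZero t}} → ℕ→ℚ t ≤ tBound N r μ →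
    ((e G /2· t) ^ℚ t) ≤ ℕ→ℚ (numMatchings G t)
lemma3p7 r μ N G Δ≤μd (suc t) 1+t≤bound =
  m^t≤[2t]^t*M⇒[m/2t]^t≤M (e G) (suc t) (numMatchings G (suc t))
    (numMatchings-lower-bound G t (2*[t*[r*Δ]]≤e G μ t Δ≤μd 1+t≤bound))
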